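{- Let $(G,\Gamma,k)$ be a yes-instance of \textsc{Dilation $t$-Augmentation}, let $S$ be a minimal solution, and let $V_S$ be the set of end-points of the edges of $S$. Then $V_c\subseteq N^t_\Gamma(V_S)$.
   Context: Let $\Gamma$ be a finite undirected unweighted graph with vertex set $V$, and let $d_\Gamma(u,v)$ denote the shortest-path (hop) distance in $\Gamma$. A graph $G$ on the same vertex set $V$ is viewed as edge-weighted: each edge $(u,v)$ of $G$ has weight $d_\Gamma(u,v)$, and $d_G(u,v)$ denotes the weighted shortest-path distance in $G$. For a set $S$ of non-edges of $G$, $G+S=(V,E(G)\cup S)$ with the same weighting rule. \textsc{Dilation $t$-Augmentation}: given $(G,\Gamma,k)$, decide whether there is a set $S$ of at most $k$ non-edges of $G$ (a solution) such that $d_{G+S}(u,v)\le t\cdot d_\Gamma(u,v)$ for all $u,v\in V$; a minimal solution is an inclusion-minimal such set. $V_c$ is the set of vertices $u$ for which there exists $v$ with $(u,v)\in E(\Gamma)$ and $d_G(u,v)>t\cdot d_\Gamma(u,v)$ (vertices in adjacent conflict in $G$). For a graph $H$, a set $W\subseteq V(H)$ and $\ell\ge 0$, $N^\ell_H(W)$ is the set of vertices at hop (unweighted) distance at most $\ell$ in $H$ from some vertex of $W$.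
   Formalization: The dilation parameter t ranges over the rationals. -}

module Defs where

open import Data.Nat using (ℕ; zero; suc; _+_; _<ᵇ_)
open import Data.Fin using (Fin; toℕ)
open import Data.List using (List; map; allFin)
open import Data.Nat.ListAction using (sum)
open import Data.Bool using (Bool; true; false; _∧_; _∨_; if_then_else_)
open import Data.Integer using (+_)
open import Data.Rational using (ℚ; _/_; _*_; _≤_)
open import Data.Product using (Σ; ∃; _×_; _,_)
open import Relation.Binary.PropositionalEquality using (_≡_)
open import Relation.Nullary using (¬_)

record Graph (n : ℕ) : Set where
  field
    adj   : Fin n → Fin n → Bool
    sym   : ∀ u v → adj u v ≡ adj v u
    irrefl : ∀ u → adj u u ≡ false
open Graph public

⟦_⟧ : ℕ → ℚ
⟦ m ⟧ = (+ m) / 1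

data Walk {n : ℕ} (H : Graph n) : Fin n → Fin n → ℕ → Set where
  nil  : ∀ {u} → Walk H u u 0
  cons : ∀ {u x v ℓ} → adj H u x ≡ true → Walk H x v ℓ → Walk H u v (suc ℓ)

-- IsHopDist Γ u v m : d_Γ(u,v) = m  (finite; no such m iff u,v disconnected).
IsHopDist : {n : ℕ} → Graph n → Fin n → Fin n → ℕ → Set
IsHopDist Γ u v m = Walk Γ u v m × (∀ ℓ → Walk Γ u v ℓ → m ≤ℕ ℓ)
  where open import Data.Nat renaming (_≤_ to _≤ℕ_)

-- WPath Γ H u v w : a walk in H from u to v whose total weight is w, where
-- each edge (x,y) of H weighs d_Γ(x,y)  (edges of infinite weight, i.e. between
-- Γ-disconnected vertices, cannot occur in a walk of finite weight).
data WPath {n : ℕ} (Γ : Graph n) (H : Graph n) : Fin n → Fin n → ℕ → Set where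
  nil  : ∀ {u} → WPath Γ H u u 0
  cons : ∀ {u x v d w} → adj H u x ≡ true → IsHopDist Γ u x d →
         WPath Γ H x v w → WPath Γ H u v (d + w)

DistLe : {n : ℕ} → Graph n → Graph n → Fin n → Fin n → ℚ → Set
DistLe Γ H u v r = Σ ℕ λ w → WPath Γ H u v w × ⟦ w ⟧ ≤ r

_⊕_ : {n : ℕ} → Graph n → Graph n → Graph n
G ⊕ S = record
  { adj = λ u v → adj G u v ∨ adj S u v
  ; sym = λ u v → cong₂ _∨_ (Graph.sym G u v) (Graph.sym S u v)
  ; irrefl = λ u → cong₂ _∨_ (Graph.irrefl G u) (Graph.irrefl S u)
  }
  where open import Relation.Binary.PropositionalEquality using (cong₂)

NonEdgesOf : {n : ℕ} → Graph n → Graph n → Set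
NonEdgesOf S G = ∀ u v → adj S u v ≡ true → adj G u v ≡ false

edgeCount : {n : ℕ} → Graph n → ℕ
edgeCount {n} H =
  sum (map (λ i → sum (map (λ j →
    if (toℕ i <ᵇ toℕ j) ∧ adj H i j then 1 else 0) (allFin n))) (allFin n))

-- the dilation condition: d_{H}(u,v) ≤ t · d_Γ(u,v) for all u, v
-- (vacuous when d_Γ(u,v) = ∞)
Dilation : {n : ℕ} → Graph n → Graph n → ℚ → Set
Dilation Γ H t = ∀ u v m → IsHopDist Γ u v m → DistLe Γ H u v (t * ⟦ m ⟧)

IsSolution : {n : ℕ} → ℚ → Graph n → Graph n → ℕ → Graph n → Set
IsSolution t G Γ k S =
  NonEdgesOf S G × (edgeCount S Data.Nat.≤ k) × Dilation Γ (G ⊕ S) t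
  where import Data.Nat

_⊊_ : {n : ℕ} → Graph n → Graph n → Set
S' ⊊ S = (∀ u v → adj S' u v ≡ true → adj S u v ≡ true)
       × (∃ λ u → ∃ λ v → adj S u v ≡ true × adj S' u v ≡ false)

IsMinimalSolution : {n : ℕ} → ℚ → Graph n → Graph n → ℕ → Graph n → Set
IsMinimalSolution t G Γ k S =
  IsSolution t G Γ k S × (∀ S' → S' ⊊ S → ¬ IsSolution t G Γ k S')

InAdjConflict : {n : ℕ} → ℚ → Graph n → Graph n → Fin n → Set
InAdjConflict t G Γ u =
  ∃ λ v → adj Γ u v ≡ true × ¬ DistLe Γ G u v (t * ⟦ 1 ⟧)

-- u ∈ N^ℓ_H(W) where W = V_S is the set of end-points of edges of S:
-- some endpoint x of an S-edge is at hop distance ≤ ℓ from u in H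
InNbhdOfEndpoints : {n : ℕ} → Graph n → ℚ → Graph n → Fin n → Set
InNbhdOfEndpoints H ℓ S u =
  ∃ λ x → (∃ λ y → adj S x y ≡ true) × ∃ λ m → Walk H u x m × ⟦ m ⟧ ≤ ℓ

{-# OPTIONS --safe #-}
-- Take a Γ-edge (u, v) in adjacent conflict. Since G + S has dilation t, there is a
-- walk from u to v in G + S of weight at most t · d_Γ(u, v) = t, and since d_G(u, v) > t
-- this walk must use an edge of S. Let x be the tail of its first S-edge: every
-- earlier edge (y, z) has weight d_Γ(y, z), realised by a Γ-walk of d_Γ(y, z) hops,
-- so x is reached from u in Γ by at most (weight of the prefix) ≤ t hops.
module Submission where

open import Defs
open import Data.Nat using (ℕ; _+_; z≤n)
import Data.Nat as ℕ
import Data.Nat.Properties as ℕ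
open import Data.Fin using (Fin)
open import Data.Integer using (+_; +≤+)
import Data.Integer.Properties as ℤ
open import Data.Rational using (ℚ; mkℚ; *≤*)
import Data.Rational as ℚ
import Data.Rational.Properties as ℚ
open import Data.Nat.Coprimality using (1-coprimeTo)
import Data.Nat.Coprimality as Coprime
open import Data.Bool using (true; false)
open import Data.Product using (∃; _×_; _,_; proj₁)
open import Data.Sum using (_⊎_; inj₁; inj₂)
open import Data.Empty using (⊥-elim)
open import Relation.Binary.PropositionalEquality using (_≡_; subst; trans)
import Relation.Binary.PropositionalEquality as ≡

⟦⟧≡mkℚ : ∀ m → ⟦ m ⟧ ≡ mkℚ (+ m) 0 (Coprime.sym (1-coprimeTo m))
⟦⟧≡mkℚ m = ℚ.normalize-coprime (Coprime.sym (1-coprimeTo m))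

⟦⟧-mono-≤ : ∀ {m w} → m ℕ.≤ w → ⟦ m ⟧ ℚ.≤ ⟦ w ⟧
⟦⟧-mono-≤ {m} {w} m≤w rewrite ⟦⟧≡mkℚ m | ⟦⟧≡mkℚ w =
  *≤* (ℤ.*-monoʳ-≤-nonNeg (+ 1) (+≤+ m≤w))

module _ {n : ℕ} where

  Walk-++ : ∀ {H : Graph n} {u x v a b} → Walk H u x a → Walk H x v b → Walk H u v (a + b)
  Walk-++ nil         q = q
  Walk-++ (cons e p)  q = cons e (Walk-++ p q)

  adj⇒IsHopDist-1 : ∀ (Γ : Graph n) {u v} → adj Γ u v ≡ true → IsHopDist Γ u v 1
  adj⇒IsHopDist-1 Γ e = cons e nil , 1≤length
    where
    1≤length : ∀ ℓ → Walk Γ _ _ ℓ → 1 ℕ.≤ ℓ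
    1≤length _ (cons _ _) = ℕ.s≤s z≤n
    1≤length _ nil with () ← trans (≡.sym e) (Graph.irrefl Γ _)

  EndpointWithin : Graph n → Graph n → Fin n → ℕ → Set
  EndpointWithin H S u m =
    ∃ λ x → (∃ λ y → adj S x y ≡ true) × ∃ λ ℓ → Walk H u x ℓ × ℓ ℕ.≤ m

  WPath-⊕-split : ∀ (Γ G S : Graph n) {u v w} → WPath Γ (G ⊕ S) u v w →
                  WPath Γ G u v w ⊎ EndpointWithin Γ S u w
  WPath-⊕-split Γ G S nil = inj₁ nil
  WPath-⊕-split Γ G S {u} (cons {x = x} {d = d} e u-x p) with adj G u x in uxInG
  ... | false = inj₂ (u , (x , e) , 0 , nil , z≤n)
  ... | true with WPath-⊕-split Γ G S p
  ...   | inj₁ q = inj₁ (cons uxInG u-x q)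
  ...   | inj₂ (y , yInS , ℓ , x-y , ℓ≤w) =
    inj₂ (y , yInS , d + ℓ , Walk-++ (proj₁ u-x) x-y , ℕ.+-monoʳ-≤ d ℓ≤w)

lemma21 : (n : ℕ) (t : ℚ) (G Γ : Graph n) (k : ℕ) (S : Graph n) →
          IsMinimalSolution t G Γ k S →
          (u : Fin n) → InAdjConflict t G Γ u → InNbhdOfEndpoints Γ t S u
lemma21 n t G Γ k S ((_ , _ , dilation) , _) u (v , uvInΓ , conflict)
  with dilation u v 1 (adj⇒IsHopDist-1 Γ uvInΓ)
... | w , p , w≤t with WPath-⊕-split Γ G S p
...   | inj₁ q = ⊥-elim (conflict (w , q , w≤t))
...   | inj₂ (x , xInS , ℓ , u-x , ℓ≤w) =
  x , xInS , ℓ , u-x , ℚ.≤-trans (⟦⟧-mono-≤ ℓ≤w) (subst (⟦ w ⟧ ℚ.≤_) (ℚ.*-identityʳ t) w≤t)
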